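{- If $G$ is a graph on $n \ge 3$ vertices such that both $G$ and its complement $\overline{G}$ are connected, then $b_{\rm g}(G)\, b_{\rm g}(\overline{G}) \le n+18$.
   Context: The burning game on a finite simple graph $G$ is played by two players, Burner and Staller. Each vertex is either burned or unburned, and once burned it stays burned. In round 1 the starting player chooses one unburned vertex and burns it (selection phase only). Each round $t \ge 2$ consists of a spreading phase, in which every unburned vertex with a burned neighbor becomes burned, followed, if unburned vertices remain, by a selection phase in which the player whose turn it is burns one unburned vertex; the two players make the selections alternately. The game ends in the first round in which all vertices are burned (this may happen right after a spreading phase), and its length is the number of that round. Burner wants to minimize the length and Staller to maximize it. $b_{\rm g}(G)$ is the length under optimal play when Burner makes the first selection. -}

module Defs where

open import Data.Nat using (ℕ; zero; suc; _+_; _⊓_; _⊔_)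
open import Data.Bool using (Bool; true; false; not; _∧_; _∨_; if_then_else_)
open import Data.Fin using (Fin; _≟_)
open import Data.List using (List; []; _∷_; foldr; filter; map)
open import Data.Bool.ListAction using (any; all)
open import Data.Fin.Base using () 
open import Data.List using () renaming (map to lmap)
open import Data.Fin.Properties using ()
open import Data.List.Base using ()
open import Data.Fin using () 
open import Relation.Nullary using (yes; no; ¬_)
open import Relation.Nullary.Decidable using (⌊_⌋)
open import Relation.Binary.PropositionalEquality using (_≡_; refl; sym)
open import Data.Bool.Properties using (∧-comm)

allFin : (n : ℕ) → List (Fin n)
allFin n = Data.List.allFin n
  where import Data.List

record Graph (n : ℕ) : Set where
  field
    adj    : Fin n → Fin n → Bool
    adj-sym    : ∀ u v → adj u v ≡ adj v u
    adj-irrefl : ∀ v → adj v v ≡ false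
open Graph public

eqb : ∀ {n} → Fin n → Fin n → Bool
eqb u v = ⌊ u ≟ v ⌋

eqb-sym : ∀ {n} (u v : Fin n) → eqb u v ≡ eqb v u
eqb-sym u v with u ≟ v | v ≟ u
... | yes _ | yes _ = refl
... | no _  | no _  = refl
... | yes refl | no q = Data.Empty.⊥-elim (q refl)
  where import Data.Empty
... | no p  | yes refl = Data.Empty.⊥-elim (p refl)
  where import Data.Empty

eqb-refl : ∀ {n} (v : Fin n) → eqb v v ≡ true
eqb-refl v with v ≟ v
... | yes _ = refl
... | no p = Data.Empty.⊥-elim (p refl)
  where import Data.Empty

complement : ∀ {n} → Graph n → Graph n
complement {n} G = record
  { adj = λ u v → not (adj G u v) ∧ not (eqb u v)
  ; adj-sym = λ u v → lemma u v
  ; adj-irrefl = λ v → irr v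
  }
  where
  lemma : ∀ u v → (not (adj G u v) ∧ not (eqb u v)) ≡ (not (adj G v u) ∧ not (eqb v u))
  lemma u v rewrite adj-sym G u v | eqb-sym u v = refl
  irr : ∀ v → (not (adj G v v) ∧ not (eqb v v)) ≡ false
  irr v rewrite eqb-refl v = ∧-comm (not (adj G v v)) false

data Reach {n} (G : Graph n) : Fin n → Fin n → Set where
  here : ∀ {v} → Reach G v v
  step : ∀ {u w v} → adj G u w ≡ true → Reach G w v → Reach G u v

Connected : ∀ {n} → Graph n → Set
Connected G = ∀ u v → Reach G u v

State : ℕ → Set
State n = Fin n → Bool

data Player : Set where
  burner staller : Player

other : Player → Player
other burner = staller
other staller = burner

spread : ∀ {n} → Graph n → State n → State n
spread {n} G B v = B v ∨ any (λ u → adj G u v ∧ B u) (allFin n)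

allBurned : ∀ {n} → State n → Bool
allBurned {n} B = all B (allFin n)

burn : ∀ {n} → Fin n → State n → State n
burn v B u = eqb u v ∨ B u

unburnedList : ∀ {n} → State n → List (Fin n)
unburnedList {n} B = Data.List.Base.filterᵇ (λ v → not (B v)) (allFin n)
  where import Data.List.Base

minList : List ℕ → ℕ
minList [] = 0
minList (x ∷ xs) = foldr _⊓_ x xs

maxList : List ℕ → ℕ
maxList = foldr _⊔_ 0

opt : Player → List ℕ → ℕ
opt burner = minList
opt staller = maxList

-- afterSel k G B p : number of further rounds the game lasts (under optimal
-- play), starting right after a selection phase which left the burned set B,
-- with player p making the next selection. Fuel k bounds the number of
-- further rounds; fuel n (the number of vertices) always suffices since each
-- non-final round burns at least one new vertex.
afterSel : ∀ {n} → ℕ → Graph n → State n → Player → ℕ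
afterSel zero G B p = 0
afterSel (suc k) G B p =
  if allBurned B then 0
  else (let B' = spread G B in
        if allBurned B' then 1
        else suc (opt p (map (λ v → afterSel k G (burn v B') (other p))
                             (unburnedList B'))))

noneBurned : ∀ {n} → State n
noneBurned _ = false

gameLength : ∀ {n} → Graph n → Player → ℕ
gameLength {n} G first =
  suc (opt first (map (λ v → afterSel n G (burn v noneBurned) (other first))
                      (allFin n)))

bg : ∀ {n} → Graph n → ℕ
bg G = gameLength G burner

-- Burner's strategy on a connected graph: whenever some vertex lies outside the
-- 2r-neighbourhood of the burned set, where r is the number of turns Burner still has,
-- select one; otherwise the fire needs at most 2r more rounds anyway. If Burner
-- has made m selections s₀ (latest), …, s_{m-1} this way, then d(sᵢ, sⱼ) > 2j for
-- i < j, so the balls of radius j around the sⱼ are pairwise disjoint, and by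
-- connectivity each has at least j + 1 vertices. Hence n ≥ 1 + 2 + ⋯ + m, and
-- b_g(G) ≤ 2m + 1 whenever n < 1 + 2 + ⋯ + (m + 1).
--
-- If G has two vertices u, v at distance at least 3, then u is at distance at most 2
-- from every vertex in the complement; otherwise every vertex of G is. So one of
-- the two factors is at most 3. Choosing m with m(m + 1)/2 ≤ n < (m + 1)(m + 2)/2,
-- the other is at most 2m + 1, and 3(2m + 1) ≤ m(m + 1)/2 + 18 for every m.

module Submission where

open import Defs
open import Data.Bool using (Bool; true; false; not; T; T?; _∨_)
open import Data.Bool.Properties using (T-∨; T-∧; T-≡)
open import Data.Empty using (⊥; ⊥-elim)
open import Data.Fin using (Fin; zero; suc; toℕ; inject₁; fromℕ; _≟_)
open import Data.Fin.Properties using (all?; ¬∀⟶∃¬; toℕ-inject₁; toℕ-fromℕ)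
open import Data.List using (List; []; _∷_; map)
open import Data.List.Membership.Propositional using (_∈_; lose)
open import Data.List.Membership.Propositional.Properties using (∈-allFin; ∈-map⁺; ∈-filter⁺)
open import Data.List.Relation.Unary.All using (universal)
open import Data.List.Relation.Unary.All.Properties using (all⁻)
open import Data.List.Relation.Unary.Any using (here; there; satisfied)
open import Data.List.Relation.Unary.Any.Properties using (any⁺; any⁻)
open import Data.Nat using (ℕ; zero; suc; _+_; _*_; _≤_; _<_; z≤n; s≤s; _⊓_)
open import Data.Nat.GeneralisedArithmetic using (iterate)
open import Data.Nat.Properties hiding (_≟_)
open import Algebra.Properties.CommutativeSemigroup +-commutativeSemigroup using (interchange)
open import Algebra.Properties.Monoid.Sum +-0-monoid using (sum; sum-init-last; sum-cong-≗)
open import Data.Nat.Tactic.RingSolver using (solve-∀)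
open import Data.Product using (∃-syntax; _×_; _,_)
open import Data.Sum using (_⊎_; inj₁; inj₂)
open import Data.Vec.Functional using (Vector; foldr; head; tail)
  renaming (_∷_ to _∷ᵛ_; [] to []ᵛ)
open import Function using (_∘_; Equivalence)
open import Relation.Binary.PropositionalEquality
  using (_≡_; _≢_; refl; sym; cong; cong₂; subst; module ≡-Reasoning)
open import Relation.Nullary using (Dec; yes; no; ¬_)
open import Relation.Nullary.Decidable using (toWitness; fromWitness)

private
  variable
    n k : ℕ

open Equivalence using (to; from)

-- Sets of vertices

_⊆_ : State n → State n → Set
X ⊆ Y = ∀ v → T (X v) → T (Y v)

Full : State n → Set
Full X = ∀ v → T (X v)

Disjoint : State n → State n → Set
Disjoint X Y = ∀ v → T (X v) → T (Y v) → ⊥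

full? : (X : State n) → Dec (Full X)
full? X = all? (λ v → T? (X v))

⁅_⁆ : Fin n → State n
⁅ s ⁆ v = eqb v s

∈-⁅⁆ : (s : Fin n) → T (⁅ s ⁆ s)
∈-⁅⁆ s = fromWitness refl

∈-⁅⁆⁻ : {s v : Fin n} → T (⁅ s ⁆ v) → v ≡ s
∈-⁅⁆⁻ = toWitness

_∪_ : State n → State n → State n
(X ∪ Y) v = X v ∨ Y v

⋃ : Vector (State n) k → State n
⋃ = foldr _∪_ noneBurned

p⊆p∪q : (X Y : State n) → X ⊆ (X ∪ Y)
p⊆p∪q X Y v = from (T-∨ {X v} {Y v}) ∘ inj₁

q⊆p∪q : (X Y : State n) → Y ⊆ (X ∪ Y)
q⊆p∪q X Y v = from (T-∨ {X v} {Y v}) ∘ inj₂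

∈-∪⁻ : (X Y : State n) {v : Fin n} → T ((X ∪ Y) v) → T (X v) ⊎ T (Y v)
∈-∪⁻ X Y {v} = to (T-∨ {X v} {Y v})

∈-⋃⁻ : (X : Vector (State n) k) {v : Fin n} → T (⋃ X v) → ∃[ j ] T (X j v)
∈-⋃⁻ {k = suc k} X {v} p with ∈-∪⁻ (head X) (⋃ (tail X)) p
... | inj₁ p₀ = zero , p₀
... | inj₂ p₁ with ∈-⋃⁻ (tail X) p₁
...   | j , pⱼ = suc j , pⱼ

T-not : ∀ {b} → ¬ T b → T (not b)
T-not {true}  ¬b = ¬b _
T-not {false} _  = _

ind : Bool → ℕ
ind true  = 1
ind false = 0

count : State n → ℕ
count {zero}  X = 0
count {suc n} X = ind (X zero) + count (X ∘ suc)

ind≤1 : ∀ a → ind a ≤ 1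
ind≤1 true  = ≤-refl
ind≤1 false = z≤n

ind-mono : ∀ {a b} → (T a → T b) → ind a ≤ ind b
ind-mono {true}  {true}  _ = ≤-refl
ind-mono {true}  {false} h = ⊥-elim (h _)
ind-mono {false}         _ = z≤n

ind-< : ∀ {a b} → ¬ T a → T b → ind a < ind b
ind-< {true}           ¬a _ = ⊥-elim (¬a _)
ind-< {false} {true}   _  _ = ≤-refl

ind-∨ : ∀ {a b} → (T a → T b → ⊥) → ind a + ind b ≤ ind (a ∨ b)
ind-∨ {true}  {true}  d = ⊥-elim (d _ _)
ind-∨ {true}  {false} _ = ≤-refl
ind-∨ {false}         _ = ≤-refl

count≤n : (X : State n) → count X ≤ n
count≤n {zero}  X = z≤n
count≤n {suc n} X = +-mono-≤ (ind≤1 (X zero)) (count≤n (X ∘ suc))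

count-mono : {X Y : State n} → X ⊆ Y → count X ≤ count Y
count-mono {zero}  _   = z≤n
count-mono {suc n} X⊆Y = +-mono-≤ (ind-mono (X⊆Y zero)) (count-mono (X⊆Y ∘ suc))

count-mono-< : {X Y : State n} {v : Fin n} → X ⊆ Y → ¬ T (X v) → T (Y v) → count X < count Y
count-mono-< {v = zero}  X⊆Y v∉X v∈Y =
  +-mono-<-≤ (ind-< v∉X v∈Y) (count-mono (X⊆Y ∘ suc))
count-mono-< {v = suc v} X⊆Y v∉X v∈Y =
  +-mono-≤-< (ind-mono (X⊆Y zero)) (count-mono-< (X⊆Y ∘ suc) v∉X v∈Y)

count-pos : {X : State n} {v : Fin n} → T (X v) → 0 < count X
count-pos {v = zero}  v∈X = <-≤-trans (ind-< (λ ()) v∈X) (m≤m+n _ _)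
count-pos {X = X} {suc v} v∈X = <-≤-trans (count-pos {X = X ∘ suc} v∈X) (m≤n+m _ _)

count-∪ : {X Y : State n} → Disjoint X Y → count X + count Y ≤ count (X ∪ Y)
count-∪ {zero}          _ = z≤n
count-∪ {suc n} {X} {Y} d = begin
  ind (X zero) + count (X ∘ suc) + (ind (Y zero) + count (Y ∘ suc))
    ≡⟨ interchange (ind (X zero)) _ _ _ ⟩
  ind (X zero) + ind (Y zero) + (count (X ∘ suc) + count (Y ∘ suc))
    ≤⟨ +-mono-≤ (ind-∨ (d zero)) (count-∪ (d ∘ suc)) ⟩
  ind ((X ∪ Y) zero) + count ((X ∪ Y) ∘ suc) ∎
  where open ≤-Reasoning

count-⋃ : (X : Vector (State n) k) → (∀ {i j} → toℕ i < toℕ j → Disjoint (X i) (X j)) →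
          sum (count ∘ X) ≤ count (⋃ X)
count-⋃ {k = zero}  X _ = z≤n
count-⋃ {k = suc k} X d = ≤-trans (+-monoʳ-≤ (count (head X)) (count-⋃ (tail X) (d ∘ s≤s)))
                                  (count-∪ head-disjoint)
  where
  head-disjoint : Disjoint (head X) (⋃ (tail X))
  head-disjoint v p q with ∈-⋃⁻ (tail X) q
  ... | j , qⱼ = d (s≤s z≤n) v p qⱼ

tri : ℕ → ℕ
tri m = sum {m} (suc ∘ toℕ)

tri-suc : ∀ m → tri (suc m) ≡ tri m + suc m
tri-suc m = begin
  tri (suc m)                                      ≡⟨ sum-init-last {m} (suc ∘ toℕ) ⟩
  sum {m} (suc ∘ toℕ ∘ inject₁) + suc (toℕ (fromℕ m))
    ≡⟨ cong₂ _+_ (sum-cong-≗ {m} (cong suc ∘ toℕ-inject₁)) (cong suc (toℕ-fromℕ m)) ⟩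
  tri m + suc m                                    ∎
  where open ≡-Reasoning

sum-mono-≤ : {a b : Vector ℕ k} → (∀ j → a j ≤ b j) → sum a ≤ sum b
sum-mono-≤ {zero}  _ = z≤n
sum-mono-≤ {suc k} h = +-mono-≤ (h zero) (sum-mono-≤ (h ∘ suc))

-- Spreading, neighbourhoods and walks

module _ (G : Graph n) where

  spread-extensive : (X : State n) → X ⊆ spread G X
  spread-extensive X = p⊆p∪q X _

  spread-adj : (X : State n) {u v : Fin n} → T (adj G u v) → T (X u) → T (spread G X v)
  spread-adj X {u} {v} a p =
    from (T-∨ {X v}) (inj₂ (any⁺ _ (lose (∈-allFin u) (from (T-∧ {adj G u v}) (a , p)))))

  spread⁻ : (X : State n) {v : Fin n} → T (spread G X v) →
            T (X v) ⊎ ∃[ u ] T (adj G u v) × T (X u)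
  spread⁻ X {v} p with to (T-∨ {X v}) p
  ... | inj₁ q = inj₁ q
  ... | inj₂ q with satisfied (any⁻ _ (allFin n) q)
  ...   | u , r = inj₂ (u , to (T-∧ {adj G u v}) r)

nbhd : Graph n → ℕ → State n → State n
nbhd G r X = iterate (spread G) X r

ball : Graph n → ℕ → Fin n → State n
ball G r s = nbhd G r ⁅ s ⁆

data Walk≤ (G : Graph n) : ℕ → Fin n → Fin n → Set where
  stay : ∀ {r x} → Walk≤ G r x x
  hop  : ∀ {r x y z} → T (adj G x y) → Walk≤ G r y z → Walk≤ G (suc r) x z

module _ {G : Graph n} where

  Walk≤-weaken : ∀ {r x y} → Walk≤ G r x y → Walk≤ G (suc r) x y
  Walk≤-weaken stay      = stay
  Walk≤-weaken (hop a w) = hop a (Walk≤-weaken w)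

  Walk≤-mono : ∀ {r s x y} → r ≤ s → Walk≤ G r x y → Walk≤ G s x y
  Walk≤-mono _         stay      = stay
  Walk≤-mono (s≤s r≤s) (hop a w) = hop a (Walk≤-mono r≤s w)

  _∷ʳ_ : ∀ {r x y z} → Walk≤ G r x y → T (adj G y z) → Walk≤ G (suc r) x z
  stay      ∷ʳ a = hop a stay
  (hop b w) ∷ʳ a = hop b (w ∷ʳ a)

  reverse : ∀ {r x y} → Walk≤ G r x y → Walk≤ G r y x
  reverse stay                  = stay
  reverse (hop {x = x} {y} a w) = reverse w ∷ʳ subst T (adj-sym G x y) a

  _++_ : ∀ {a b x y z} → Walk≤ G a x y → Walk≤ G b y z → Walk≤ G (a + b) x z
  _++_ {a} {b} stay w = Walk≤-mono (m≤n+m b a) w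
  hop e w ++ w′ = hop e (w ++ w′)

module _ (G : Graph n) where

  nbhd-extensive : ∀ r (X : State n) → X ⊆ nbhd G r X
  nbhd-extensive zero    X v p = p
  nbhd-extensive (suc r) X v p = nbhd-extensive r (spread G X) v (spread-extensive G X v p)

  nbhd⁺ : ∀ {r} (X : State n) {x v} → T (X x) → Walk≤ G r x v → T (nbhd G r X v)
  nbhd⁺ {r} X p stay = nbhd-extensive r X _ p
  nbhd⁺ X p (hop a w) = nbhd⁺ (spread G X) (spread-adj G X a p) w

  nbhd⁻ : ∀ r (X : State n) {v} → T (nbhd G r X v) → ∃[ x ] T (X x) × Walk≤ G r x v
  nbhd⁻ zero    X p = _ , p , stay
  nbhd⁻ (suc r) X p with nbhd⁻ r (spread G X) p
  ... | y , q , w with spread⁻ G X q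
  ...   | inj₁ q′           = y , q′ , Walk≤-weaken w
  ...   | inj₂ (x , a , q′) = x , q′ , hop a w

  nbhd-mono : ∀ r {X Y : State n} → X ⊆ Y → nbhd G r X ⊆ nbhd G r Y
  nbhd-mono r {X} {Y} X⊆Y v p with nbhd⁻ r X p
  ... | x , q , w = nbhd⁺ Y (X⊆Y x q) w

  spread-mono : {X Y : State n} → X ⊆ Y → spread G X ⊆ spread G Y
  spread-mono = nbhd-mono 1

  nbhd-mono-r : ∀ {a b} (X : State n) → a ≤ b → nbhd G a X ⊆ nbhd G b X
  nbhd-mono-r {a} X a≤b v p with nbhd⁻ a X p
  ... | x , q , w = nbhd⁺ X q (Walk≤-mono a≤b w)

  nbhd-+ : ∀ a b (X : State n) → nbhd G (a + b) X ≡ nbhd G b (nbhd G a X)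
  nbhd-+ zero    b X = refl
  nbhd-+ (suc a) b X = nbhd-+ a b (spread G X)

  nbhd-suc : ∀ r (X : State n) → nbhd G (suc r) X ≡ spread G (nbhd G r X)
  nbhd-suc zero    X = refl
  nbhd-suc (suc r) X = nbhd-suc r (spread G X)

  ball⁺ : ∀ {r s v} → Walk≤ G r s v → T (ball G r s v)
  ball⁺ {s = s} = nbhd⁺ ⁅ s ⁆ (∈-⁅⁆ s)

  ball⁻ : ∀ r s {v} → T (ball G r s v) → Walk≤ G r s v
  ball⁻ r s p with nbhd⁻ r ⁅ s ⁆ p
  ... | x , q , w with ∈-⁅⁆⁻ q
  ...   | refl = w

  ball-triangle : ∀ a b {s t v} → T (ball G a s v) → T (ball G b t v) → T (ball G (b + a) t s)
  ball-triangle a b p q = ball⁺ (ball⁻ b _ q ++ reverse (ball⁻ a _ p))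

  frontier : ∀ (Z : State n) {x y} → Reach G x y → T (Z x) → ¬ T (Z y) →
             ∃[ w ] ¬ T (Z w) × T (spread G Z w)
  frontier Z here                 p ¬q = ⊥-elim (¬q p)
  frontier Z (step {w = w} a r) p ¬q with T? (Z w)
  ... | yes p′ = frontier Z r p′ ¬q
  ... | no ¬p′ = w , ¬p′ , spread-adj G Z (from T-≡ a) p

  nbhd-count : Connected G → ∀ r (X : State n) {x y} → T (X x) → ¬ T (nbhd G r X y) →
               suc r ≤ count (nbhd G r X)
  nbhd-count conn zero    X p ¬q = count-pos {X = X} p
  nbhd-count conn (suc r) X {x} {y} p ¬q =
    let w , w∉ , w∈ = frontier (nbhd G r X) (conn x y) (nbhd-extensive r X x p) (¬q ∘ grow y) in
    ≤-trans (s≤s (nbhd-count conn r X p (¬q ∘ grow y)))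
            (count-mono-< grow w∉ (subst (λ Y → T (Y w)) (sym (nbhd-suc r X)) w∈))
    where
    grow : nbhd G r X ⊆ nbhd G (suc r) X
    grow = nbhd-mono-r X (n≤1+n r)

-- Bounds on the length of the game

allBurned⁺ : (X : State n) → Full X → T (allBurned X)
allBurned⁺ {n} X full = all⁻ X (universal full (allFin n))

∈-unburnedList⁺ : (B : State n) {v : Fin n} → ¬ T (B v) → v ∈ unburnedList B
∈-unburnedList⁺ B {v} ¬p = ∈-filter⁺ (T? ∘ (not ∘ B)) (∈-allFin v) (T-not ¬p)

foldr-⊓-≤ : ∀ {y z} ys → y ∈ z ∷ ys → Data.List.foldr _⊓_ z ys ≤ y
foldr-⊓-≤ []       (here refl)         = ≤-refl
foldr-⊓-≤ (w ∷ ys) (here refl)         = ≤-trans (m⊓n≤n w _) (foldr-⊓-≤ ys (here refl))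
foldr-⊓-≤ (w ∷ ys) (there (here refl)) = m⊓n≤m w _
foldr-⊓-≤ (w ∷ ys) (there (there m))   = ≤-trans (m⊓n≤n w _) (foldr-⊓-≤ ys (there m))

minList-≤ : ∀ ys {y} → y ∈ ys → minList ys ≤ y
minList-≤ (z ∷ ys) = foldr-⊓-≤ ys

opt-≤ : ∀ {A : Set} p (g : A → ℕ) xs {d} → (∀ x → g x ≤ d) → opt p (map g xs) ≤ d
opt-≤ burner  g []       h = z≤n
opt-≤ burner  g (x ∷ xs) h = ≤-trans (minList-≤ (map g (x ∷ xs)) (here refl)) (h x)
opt-≤ staller g []       h = z≤n
opt-≤ staller g (x ∷ xs) h = ⊔-lub (h x) (opt-≤ staller g xs h)

options : ℕ → Graph n → State n → Player → List ℕ
options k G B p =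
  map (λ v → afterSel k G (burn v (spread G B)) (other p)) (unburnedList (spread G B))

afterSel-suc-≤ : ∀ {k d} (G : Graph n) p (B : State n) →
                 (¬ Full (spread G B) → opt p (options k G B p) ≤ d) →
                 afterSel (suc k) G B p ≤ suc d
afterSel-suc-≤ G p B h with allBurned B
... | true  = z≤n
... | false with allBurned (spread G B) in eq
...   | true  = s≤s z≤n
...   | false = s≤s (h (λ full → subst T eq (allBurned⁺ (spread G B) full)))

afterSel-≤-full : ∀ k d (G : Graph n) p (B : State n) →
                  Full (nbhd G d B) → afterSel k G B p ≤ d
afterSel-≤-full zero    d       G p B full = z≤n
afterSel-≤-full (suc k) zero    G p B full with allBurned B in eq
... | true  = z≤n
... | false = ⊥-elim (subst T eq (allBurned⁺ B full))
afterSel-≤-full (suc k) (suc d) G p B full =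
  afterSel-suc-≤ {k = k} G p B λ _ → opt-≤ p _ _ λ v →
    afterSel-≤-full k d G (other p) (burn v (spread G B))
      (λ w → nbhd-mono G d (q⊆p∪q ⁅ v ⁆ (spread G B)) w (full w))

options-burner-≤ : ∀ {k d} (G : Graph n) (B : State n) {v : Fin n} → ¬ T (spread G B v) →
                   afterSel k G (burn v (spread G B)) staller ≤ d →
                   opt burner (options k G B burner) ≤ d
options-burner-≤ G B v∉ = ≤-trans (minList-≤ _ (∈-map⁺ _ (∈-unburnedList⁺ (spread G B) v∉)))

bg-≤ : (G : Graph n) (x : Fin n) {d : ℕ} →
       afterSel n G (burn x noneBurned) staller ≤ d → bg G ≤ suc d
bg-≤ {n} G x h = s≤s (≤-trans (minList-≤ _ (∈-map⁺ _ (∈-allFin x))) h)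

bg-≤-radius : (G : Graph n) {x : Fin n} (r : ℕ) → Full (ball G r x) → bg G ≤ suc r
bg-≤-radius {n} G {x} r full = bg-≤ G x (afterSel-≤-full n r G staller (burn x noneBurned)
  (λ v → nbhd-mono G r (p⊆p∪q ⁅ x ⁆ noneBurned) v (full v)))

-- Burner's strategy on a connected graph

-- ss j is Burner's j-th latest selection, and q in Separated q counts the selections
-- she may still make.
module BurnerStrategy (G : Graph n) (conn : Connected G) where

  Separated : ℕ → Vector (Fin n) k → Set
  Separated q ss = ∀ i j → toℕ i < toℕ j → ¬ T (ball G (2 * (q + toℕ j)) (ss j) (ss i))

  Protected : (ℕ → ℕ) → Vector (Fin n) k → State n → Set
  Protected ρ ss B = ∀ j → ball G (ρ (toℕ j)) (ss j) ⊆ B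

  separated⇒tri≤n : (ss : Vector (Fin n) k) → Separated 0 ss → tri k ≤ n
  separated⇒tri≤n {k} ss sep = begin
    tri k               ≤⟨ sum-mono-≤ size ⟩
    sum (count ∘ balls) ≤⟨ count-⋃ balls disjoint ⟩
    count (⋃ balls)     ≤⟨ count≤n _ ⟩
    n                   ∎
    where
    open ≤-Reasoning
    balls : Vector (State n) k
    balls j = ball G (toℕ j) (ss j)

    disjoint : ∀ {i j} → toℕ i < toℕ j → Disjoint (balls i) (balls j)
    disjoint {i} {j} i<j v p q =
      sep i j i<j (nbhd-mono-r G ⁅ ss j ⁆ j+i≤2j (ss i) (ball-triangle G (toℕ i) (toℕ j) p q))
      where j+i≤2j = +-monoʳ-≤ (toℕ j) (≤-trans (<⇒≤ i<j) (m≤m+n (toℕ j) 0))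

    size : ∀ j → suc (toℕ j) ≤ count (balls j)
    size zero    = count-pos {X = balls zero} (∈-⁅⁆ (ss zero))
    size (suc j) = nbhd-count G conn (toℕ (suc j)) ⁅ ss (suc j) ⁆ (∈-⁅⁆ (ss (suc j)))
      (sep zero (suc j) (s≤s z≤n) ∘ nbhd-mono-r G ⁅ ss (suc j) ⁆ (m≤m+n (suc (toℕ j)) _) (ss zero))

  Protected-mono : ∀ ρ (ss : Vector (Fin n) k) {B B′ : State n} →
                   B ⊆ B′ → Protected ρ ss B → Protected ρ ss B′
  Protected-mono ρ ss B⊆B′ prot j v = B⊆B′ v ∘ prot j v

  Protected-≤ : ∀ {ρ} ρ′ (ss : Vector (Fin n) k) {B : State n} →
                (∀ i → ρ′ i ≤ ρ i) → Protected ρ ss B → Protected ρ′ ss B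
  Protected-≤ ρ′ ss ρ′≤ρ prot j v = prot j v ∘ nbhd-mono-r G ⁅ ss j ⁆ (ρ′≤ρ (toℕ j)) v

  Protected-spread : ∀ ρ (ss : Vector (Fin n) k) {B : State n} →
                     Protected ρ ss B → Protected (λ i → suc (ρ i)) ss (spread G B)
  Protected-spread ρ ss prot j v p =
    spread-mono G (prot j) v (subst (λ Y → T (Y v)) (nbhd-suc G (ρ (toℕ j)) ⁅ ss j ⁆) p)

  select-far : ∀ r (ss : Vector (Fin n) k) (B : State n) {s} →
               Separated (suc r) ss → Protected (λ i → suc (2 * i)) ss B →
               ¬ T (nbhd G (2 * r) (spread G B) s) →
               Separated r (s ∷ᵛ ss) × Protected (2 *_) (s ∷ᵛ ss) (burn s (spread G B))
  select-far r ss B {s} sep prot far = sep′ , prot′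
    where
    prot″ : Protected (λ i → suc (suc (2 * i))) ss (spread G B)
    prot″ = Protected-spread (λ i → suc (2 * i)) ss prot

    sep′ : Separated r (s ∷ᵛ ss)
    sep′ zero    (suc j) _ p = far (nbhd-mono G (2 * r) (prot″ j) s
      (subst (λ Y → T (Y s)) (nbhd-+ G (suc (suc (2 * toℕ j))) (2 * r) ⁅ ss j ⁆)
        (subst (λ t → T (ball G t (ss j) s)) (radius r (toℕ j)) p)))
      where
      radius : ∀ r j → 2 * (r + suc j) ≡ suc (suc (2 * j)) + 2 * r
      radius = solve-∀
    sep′ (suc i) (suc j) (s≤s i<j) =
      subst (λ t → ¬ T (ball G (2 * t) (ss j) (ss i))) (sym (+-suc r (toℕ j))) (sep i j i<j)

    prot′ : Protected (2 *_) (s ∷ᵛ ss) (burn s (spread G B))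
    prot′ zero    = p⊆p∪q ⁅ s ⁆ (spread G B)
    prot′ (suc j) = Protected-mono (λ i → 2 * suc i) ss (q⊆p∪q ⁅ s ⁆ (spread G B))
                      (Protected-≤ (λ i → 2 * suc i) ss (λ i → ≤-reflexive (*-suc 2 i)) prot″) j

  mutual
    afterSel-staller-≤ : ∀ r fuel (ss : Vector (Fin n) k) (B : State n) → n < tri (k + r) →
                         Separated r ss → Protected (2 *_) ss B →
                         afterSel fuel G B staller ≤ 2 * r
    afterSel-staller-≤ {k} zero fuel ss B n<tri sep _ =
      ⊥-elim (<⇒≱ n<tri (subst (λ t → tri t ≤ n) (sym (+-identityʳ k)) (separated⇒tri≤n ss sep)))
    afterSel-staller-≤ (suc r) zero       ss B _     _   _    = z≤n
    afterSel-staller-≤ (suc r) (suc fuel) ss B n<tri sep prot =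
      ≤-trans (afterSel-suc-≤ {k = fuel} G staller B λ _ →
                 opt-≤ staller _ (unburnedList (spread G B)) λ v →
                   afterSel-burner-≤ r fuel ss (burn v (spread G B)) n<tri sep (prot′ v))
              (≤-reflexive (sym (*-suc 2 r)))
      where
      prot′ : ∀ v → Protected (λ i → suc (2 * i)) ss (burn v (spread G B))
      prot′ v = Protected-mono (λ i → suc (2 * i)) ss (q⊆p∪q ⁅ v ⁆ (spread G B))
                  (Protected-spread (2 *_) ss prot)

    afterSel-burner-≤ : ∀ r fuel (ss : Vector (Fin n) k) (B : State n) → n < tri (k + suc r) →
                        Separated (suc r) ss → Protected (λ i → suc (2 * i)) ss B →
                        afterSel fuel G B burner ≤ suc (2 * r)
    afterSel-burner-≤ r zero ss B _ _ _ = z≤n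
    afterSel-burner-≤ {k} r (suc fuel) ss B n<tri sep prot =
      afterSel-suc-≤ {k = fuel} G burner B select
      where
      select : ¬ Full (spread G B) → opt burner (options fuel G B burner) ≤ 2 * r
      select ¬full with full? (nbhd G (2 * r) (spread G B))
      ... | yes full =
        let v , v∉ = ¬∀⟶∃¬ n _ (T? ∘ spread G B) ¬full in
        options-burner-≤ {k = fuel} G B v∉
          (afterSel-≤-full fuel (2 * r) G staller (burn v (spread G B))
            (λ w → nbhd-mono G (2 * r) (q⊆p∪q ⁅ v ⁆ (spread G B)) w (full w)))
      ... | no ¬full′ =
        let s , far      = ¬∀⟶∃¬ n _ (T? ∘ nbhd G (2 * r) (spread G B)) ¬full′
            sep′ , prot′ = select-far r ss B sep prot far in
        options-burner-≤ {k = fuel} G B (far ∘ nbhd-extensive G (2 * r) (spread G B) s)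
          (afterSel-staller-≤ r fuel (s ∷ᵛ ss) (burn s (spread G B))
            (subst (λ t → n < tri t) (+-suc k r) n<tri) sep′ prot′)

  bg-≤-tri : Fin n → ∀ m → n < tri (suc m) → bg G ≤ suc (2 * m)
  bg-≤-tri x m n<tri = bg-≤ G x (afterSel-staller-≤ m n (x ∷ᵛ []ᵛ) (burn x noneBurned) n<tri
    (λ { zero zero () }) (λ { zero → p⊆p∪q ⁅ x ⁆ noneBurned }))

-- The complement and the final estimate

complement-adj : (G : Graph n) {x y : Fin n} →
                 ¬ T (adj G x y) → x ≢ y → T (adj (complement G) x y)
complement-adj G {x} ¬a x≢y = from (T-∧ {not (adj G x _)}) (T-not ¬a , T-not (x≢y ∘ toWitness))

complement-ball₂ : (G : Graph n) {u v : Fin n} →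
                   ¬ T (ball G 2 u v) → Full (ball (complement G) 2 u)
complement-ball₂ G {u} {v} v∉ w = ball⁺ (complement G) (walk (w ≟ u) (T? (adj G u w)))
  where
  ūv : T (adj (complement G) u v)
  ūv = complement-adj G (λ a → v∉ (ball⁺ G {2} (hop a stay)))
                        (λ { refl → v∉ (ball⁺ G {2} stay) })

  walk : Dec (w ≡ u) → Dec (T (adj G u w)) → Walk≤ (complement G) 2 u w
  walk (yes refl) _        = stay
  walk (no w≢u)   (no ¬uw) = hop (complement-adj G ¬uw (w≢u ∘ sym)) stay
  walk (no _)     (yes uw) = hop ūv (hop v̄w stay)
    where
    v̄w : T (adj (complement G) v w)
    v̄w = complement-adj G (λ a → v∉ (ball⁺ G {2} (hop uw (hop (subst T (adj-sym G v w) a) stay))))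
                          (λ { refl → v∉ (ball⁺ G {2} (hop uw stay)) })

triangular-root : ∀ n → ∃[ m ] tri m ≤ n × n < tri (suc m)
triangular-root zero = 0 , z≤n , s≤s z≤n
triangular-root (suc n) with triangular-root n
... | m , lo , hi with suc n <? tri (suc m)
...   | yes hi′ = m , m≤n⇒m≤1+n lo , hi′
...   | no ¬hi′ = suc m , ≮⇒≥ ¬hi′ ,
                  subst (suc n <_) (sym (tri-suc (suc m)))
                        (≤-<-trans hi (m<m+n (tri (suc m)) (s≤s z≤n)))

-- Equivalent to (m − 5)(m − 6) ≥ 0, with equality at m = 5 and m = 6.
tri-bound : ∀ m → 3 * suc (2 * m) ≤ tri m + 18
tri-bound 0 = ≤ᵇ⇒≤ _ _ _
tri-bound 1 = ≤ᵇ⇒≤ _ _ _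
tri-bound 2 = ≤ᵇ⇒≤ _ _ _
tri-bound 3 = ≤ᵇ⇒≤ _ _ _
tri-bound 4 = ≤ᵇ⇒≤ _ _ _
tri-bound 5 = ≤ᵇ⇒≤ _ _ _
tri-bound (suc m@(suc (suc (suc (suc (suc _)))))) = begin
  3 * suc (2 * suc m)   ≡⟨ expand m ⟩
  6 + 3 * suc (2 * m)   ≤⟨ +-mono-≤ (m≤m+n 6 _) (tri-bound m) ⟩
  suc m + (tri m + 18)  ≡⟨ shuffle (tri m) m ⟩
  tri m + suc m + 18    ≡⟨ cong (_+ 18) (sym (tri-suc m)) ⟩
  tri (suc m) + 18      ∎
  where
  open ≤-Reasoning
  expand : ∀ m → 3 * suc (2 * suc m) ≡ 6 + 3 * suc (2 * m)
  expand = solve-∀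
  shuffle : ∀ t m → suc m + (t + 18) ≡ t + suc m + 18
  shuffle = solve-∀

product-bound : ∀ {n m a b} → tri m ≤ n → a ≤ 3 → b ≤ suc (2 * m) → a * b ≤ n + 18
product-bound {m = m} tri≤n a≤3 b≤ =
  ≤-trans (*-mono-≤ a≤3 b≤) (≤-trans (tri-bound m) (+-monoˡ-≤ 18 tri≤n))

corollary3p6 : (n : ℕ) → 3 ≤ n → (G : Graph n) → Connected G → Connected (complement G) →
    bg G * bg (complement G) ≤ n + 18
corollary3p6 (suc n) _ G G-conn Ḡ-conn with triangular-root (suc n) | full? (ball G 2 zero)
... | m , tri≤n , n<tri | yes rad₂ =
  product-bound {m = m} tri≤n (bg-≤-radius G 2 rad₂)
    (BurnerStrategy.bg-≤-tri (complement G) Ḡ-conn zero m n<tri)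
... | m , tri≤n , n<tri | no ¬rad₂ =
  let v , v∉ = ¬∀⟶∃¬ _ _ (T? ∘ ball G 2 zero) ¬rad₂ in
  subst (_≤ suc n + 18) (*-comm (bg (complement G)) (bg G))
    (product-bound {m = m} tri≤n (bg-≤-radius (complement G) 2 (complement-ball₂ G {zero} {v} v∉))
      (BurnerStrategy.bg-≤-tri G G-conn zero m n<tri))
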